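{- Let $(W,S)$ be a Coxeter system, let $w\in W$ be torically reduced, and let $\mathsf{w}$ be any reduced word for $w$. If $\mathcal{R}_{\mathrm{tor}}([w])$ is torically order-theoretic, then $\mathcal{R}_{\mathrm{tor}}([w])=\mathcal{L}_{\mathrm{tor}}(\mathcal{T}(\mathsf{w}))$.
   Context: $(W,S)$ is a Coxeter system with bond strengths $m(s,t)$ (order of $st$, $m(s,s)=1$) and Coxeter graph $\Gamma$. For distinct $s,t$, $\langle s,t\rangle_k=stst\cdots$ ($k$ letters). A braid relation replaces a consecutive subword $\langle s,t\rangle_{m(s,t)}$ by $\langle t,s\rangle_{m(s,t)}$; short if $m(s,t)=2$. The cyclic word $[\mathsf{w}]$ of a word $\mathsf{w}$ is the set of its cyclic shifts. Two cyclic words differ by a (short) braid if some representative of one is converted into some representative of the other by one (short) braid relation; $\approx$ (resp. $\sim$) is the equivalence on cyclic words generated by braids (resp. short braids). A word is torically reduced if it remains reduced under any sequence of cyclic shifts and/or braid relations; an element $w\in W$ is torically reduced if any (equivalently every) reduced word for it is. For torically reduced $w$ with reduced word $\mathsf{w}$, $\mathcal{R}_{\mathrm{tor}}([w])=\{[\mathsf{u}]:[\mathsf{u}]\approx[\mathsf{w}]\}$ (independent of the choice of $\mathsf{w}$). Toric posets and heaps: for a finite graph $G$ and acyclic orientation $\omega$, source-to-sink conversions generate an equivalence $\equiv$; the class is the toric poset $T(G,[\omega])$. For $\mathsf{w}=s_{x_1}\cdots s_{x_m}$, let $G_\mathsf{w}$ be the graph on $[m]$ with an edge $\{i,j\}$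 for $i\ne j$ with $m(s_{x_i},s_{x_j})\neq 2$, oriented $i\to j$ for $i<j$ (orientation $\omega_\mathsf{w}$); the toric heap is $\mathcal{T}(\mathsf{w})=(T(G_\mathsf{w},[\omega_\mathsf{w}]),\Gamma,i\mapsto s_{x_i})$. A total toric extension of $\mathcal{T}(\mathsf{w})$ is a linear ordering $(i_1,\dots,i_m)$ of $[m]$ up to cyclic rotation such that the orientation of $K_m$ it induces ($i_a\to i_b$ for $a<b$), restricted to the edges of $G_\mathsf{w}$, is toric equivalent to $\omega_\mathsf{w}$; it is recorded as the cyclic word $[s_{x_{i_1}}\cdots s_{x_{i_m}}]$, and $\mathcal{L}_{\mathrm{tor}}(\mathcal{T}(\mathsf{w}))$ is the set of all such cyclic words. A set of cyclic words is torically order-theoretic if it equals $\mathcal{L}_{\mathrm{tor}}(\mathcal{T}(\mathsf{u}))$ for some torically reduced word $\mathsf{u}$. -}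

module Defs where

open import Data.Nat using (ℕ; zero; suc; _≤_)
open import Data.Bool using (Bool; true; false; not; if_then_else_; _∨_)
open import Data.List using (List; []; _∷_; _++_; length; map; lookup)
open import Data.Fin using (Fin; _<?_; _≟_)
open import Data.Fin.Permutation using (Permutation′; _⟨$⟩ʳ_; _⟨$⟩ˡ_)
open import Data.List using (allFin)
open import Data.Product using (Σ; ∃; ∃-syntax; _×_; _,_)
open import Data.Sum using (_⊎_)
open import Relation.Binary.PropositionalEquality using (_≡_; _≢_)
open import Relation.Binary.Construct.Closure.ReflexiveTransitive using (Star)
open import Relation.Nullary.Decidable using (⌊_⌋)

data ℕ∞ : Set where
  fin : ℕ → ℕ∞
  ∞   : ℕ∞

-- A Coxeter matrix on a (possibly infinite) generating set S.
-- (W,S) is the Coxeter system presented by it: W = ⟨ S | (st)^m(s,t) = 1 ⟩.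
record CoxeterMatrix (S : Set) : Set where
  field
    m      : S → S → ℕ∞
    m-diag : ∀ s → m s s ≡ fin 1
    m-sym  : ∀ s t → m s t ≡ m t s
    m-off  : ∀ s t → s ≢ t → (m s t ≢ fin 0) × (m s t ≢ fin 1)

module Coxeter {S : Set} (M : CoxeterMatrix S) where
  open CoxeterMatrix M

  Word : Set
  Word = List S

  alt : S → S → ℕ → Word
  alt s t zero    = []
  alt s t (suc k) = s ∷ alt t s k

  Braid : Word → Word → Set
  Braid w w' = ∃[ a ] ∃[ b ] ∃[ s ] ∃[ t ] ∃[ k ]
    (s ≢ t × m s t ≡ fin k × w ≡ a ++ alt s t k ++ b × w' ≡ a ++ alt t s k ++ b)

  Cancel : Word → Word → Set
  Cancel w w' = ∃[ a ] ∃[ b ] ∃[ s ] (w ≡ a ++ s ∷ s ∷ b × w' ≡ a ++ b)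

  -- equality in W of the elements represented by two words
  -- (congruence generated by the defining relations of the presentation)
  WStep : Word → Word → Set
  WStep w w' = Cancel w w' ⊎ Cancel w' w ⊎ Braid w w'

  _=W_ : Word → Word → Set
  _=W_ = Star WStep

  Reduced : Word → Set
  Reduced w = ∀ v → v =W w → length w ≤ length v

  -- w' is a cyclic shift of w  (so [w] = { w' | CycShift w w' })
  CycShift : Word → Word → Set
  CycShift w w' = ∃[ u ] ∃[ v ] (w ≡ u ++ v × w' ≡ v ++ u)

  TorStep : Word → Word → Set
  TorStep w w' = CycShift w w' ⊎ Braid w w'

  -- [u] ≈ [w] is exactly  u ⇝tor w  (equivalence generated by braids on cyclic words)
  _⇝tor_ : Word → Word → Set
  _⇝tor_ = Star TorStep

  TorReduced : Word → Set
  TorReduced w = ∀ u → w ⇝tor u → Reduced u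

  -- R_tor([w]) for a (torically reduced) reduced word w, as the set of all
  -- words whose cyclic word lies in it
  Rtor : Word → Word → Set
  Rtor w u = w ⇝tor u

  module _ (w : Word) where
    private
      n = length w
    letter : Fin n → S
    letter i = lookup w i

    Edge : Fin n → Fin n → Set
    Edge i j = i ≢ j × m (letter i) (letter j) ≢ fin 2

    -- an orientation: o i j ≡ true means the edge {i,j} is oriented i → j
    Orientation : Set
    Orientation = Fin n → Fin n → Bool

    ω : Orientation
    ω i j = ⌊ i <? j ⌋

    IsSource : Orientation → Fin n → Set
    IsSource o v = ∀ j → Edge v j → o v j ≡ true

    flipAt : Fin n → Orientation → Orientation
    flipAt v o i j = if ⌊ i ≟ v ⌋ ∨ ⌊ j ≟ v ⌋ then not (o i j) else o i j

    AgreeOnEdges : Orientation → Orientation → Set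
    AgreeOnEdges o o' = ∀ i j → Edge i j → o i j ≡ o' i j

    SourceToSink : Orientation → Orientation → Set
    SourceToSink o o' = ∃[ v ] (IsSource o v × AgreeOnEdges (flipAt v o) o')

    ToricStep : Orientation → Orientation → Set
    ToricStep o o' = SourceToSink o o' ⊎ SourceToSink o' o ⊎ AgreeOnEdges o o'

    _≡tor_ : Orientation → Orientation → Set
    _≡tor_ = Star ToricStep

    -- linear ordering (i₁,…,iₙ): position k ↦ vertex σ ⟨$⟩ʳ k
    induced : Permutation′ n → Orientation
    induced σ i j = ⌊ (σ ⟨$⟩ˡ i) <? (σ ⟨$⟩ˡ j) ⌋

    IsTotalToricExtension : Permutation′ n → Set
    IsTotalToricExtension σ = ω ≡tor induced σ

    wordOf : Permutation′ n → Word
    wordOf σ = map (λ k → letter (σ ⟨$⟩ʳ k)) (allFin n)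

    -- L_tor(T(w)), as the set of all words whose cyclic word lies in it
    Ltor : Word → Set
    Ltor u = ∃[ σ ] (IsTotalToricExtension σ × CycShift (wordOf σ) u)

  SameSet : (Word → Set) → (Word → Set) → Set
  SameSet P Q = ∀ u → (P u → Q u) × (Q u → P u)

  TorOrderTheoretic : (Word → Set) → Set
  TorOrderTheoretic X = ∃[ u ] (TorReduced u × SameSet X (Ltor u))

-- Since w ∈ R_tor([w]) = L_tor(T(u)), some total toric extension σ of T(u) reads off a
-- cyclic shift of w. Toric heaps, and hence their sets of total toric extensions, are
-- invariant under relabelling along a letter-preserving bijection that carries the
-- orientation to a toric-equivalent one. Reading off σ is such a relabelling, and so is
-- moving the first letter to the end (the orientation of the rotated word is the original
-- one with the source 0 converted to a sink). Hence L_tor(T(u)) = L_tor(T(w)).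
module Submission where

open import Defs
open import Data.Bool using (true; false; not; if_then_else_; _∨_)
open import Data.Empty using (⊥-elim)
open import Function using (_∘_)
open import Data.Fin using (Fin; zero; suc; cast; toℕ; fromℕ; inject₁; _≟_; _<?_)
open import Data.Fin.Permutation
  using (Permutation; Permutation′; _⟨$⟩ʳ_; _⟨$⟩ˡ_; permutation; inverseˡ; inverseʳ; flip; _∘ₚ_; cast-id; ↔⇒≡)
open import Data.Fin.Properties using (toℕ-cast; cast-is-id; toℕ-inject₁; toℕ-fromℕ; toℕ<n)
open import Data.List using ([]; _∷_; _++_; length; map; lookup; allFin; tabulate)
open import Data.List.Properties
  using (map-tabulate; tabulate-cong; tabulate-lookup; ++-assoc; ++-identityʳ; length-tabulate)
open import Data.Nat as ℕ using (s≤s)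
open import Data.Nat.Properties using (<-asym)
open import Data.Product using (_,_; proj₁; proj₂)
open import Data.Sum using (inj₁; inj₂)
open import Relation.Binary.Construct.Closure.ReflexiveTransitive using (ε; _◅_; _◅◅_; gmap; reverse)
open import Relation.Binary.PropositionalEquality
open import Relation.Nullary using (Dec; yes; no; ¬_)
open import Relation.Nullary.Decidable using (⌊_⌋)

isYes-cong : ∀ {P Q : Set} (p? : Dec P) (q? : Dec Q) → (P → Q) → (Q → P) → ⌊ p? ⌋ ≡ ⌊ q? ⌋
isYes-cong (yes p) (yes q) _   _   = refl
isYes-cong (no ¬p) (no ¬q) _   _   = refl
isYes-cong (yes p) (no ¬q) P→Q _   = ⊥-elim (¬q (P→Q p))
isYes-cong (no ¬p) (yes q) _   Q→P = ⊥-elim (¬p (Q→P q))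

isYes-true : ∀ {P : Set} (p? : Dec P) → P → ⌊ p? ⌋ ≡ true
isYes-true p? p = isYes-cong p? (yes p) (λ q → q) (λ q → q)

isYes-false : ∀ {P : Set} (p? : Dec P) → ¬ P → ⌊ p? ⌋ ≡ false
isYes-false p? ¬p = isYes-cong p? (no ¬p) (λ q → q) (λ q → q)

<?-toℕ : ∀ {m n m′ n′} {i : Fin m} {j : Fin n} {i′ : Fin m′} {j′ : Fin n′} →
         toℕ i ≡ toℕ i′ → toℕ j ≡ toℕ j′ → ⌊ i <? j ⌋ ≡ ⌊ i′ <? j′ ⌋
<?-toℕ = cong₂ (λ a b → ⌊ a ℕ.<? b ⌋)

sucIfNonzero : ∀ {k} → Fin (ℕ.suc k) → Fin (ℕ.suc (ℕ.suc k))
sucIfNonzero zero    = zero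
sucIfNonzero (suc i) = suc (suc i)

cyclicSuc : ∀ {k} → Fin (ℕ.suc k) → Fin (ℕ.suc k)
cyclicSuc {ℕ.zero}  zero    = zero
cyclicSuc {ℕ.suc k} zero    = suc zero
cyclicSuc {ℕ.suc k} (suc i) = sucIfNonzero (cyclicSuc i)

cyclicPred : ∀ {k} → Fin (ℕ.suc k) → Fin (ℕ.suc k)
cyclicPred {k} zero = fromℕ k
cyclicPred (suc i)  = inject₁ i

cyclicPred-sucIfNonzero : ∀ {k} (i : Fin (ℕ.suc k)) → cyclicPred (sucIfNonzero i) ≡ suc (cyclicPred i)
cyclicPred-sucIfNonzero zero    = refl
cyclicPred-sucIfNonzero (suc i) = refl

cyclicPred-cyclicSuc : ∀ {k} (i : Fin (ℕ.suc k)) → cyclicPred (cyclicSuc i) ≡ i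
cyclicPred-cyclicSuc {ℕ.zero}  zero    = refl
cyclicPred-cyclicSuc {ℕ.suc k} zero    = refl
cyclicPred-cyclicSuc {ℕ.suc k} (suc i) =
  trans (cyclicPred-sucIfNonzero (cyclicSuc i)) (cong suc (cyclicPred-cyclicSuc i))

cyclicSuc-inject₁ : ∀ {k} (i : Fin (ℕ.suc k)) → cyclicSuc (inject₁ i) ≡ suc i
cyclicSuc-inject₁ zero                = refl
cyclicSuc-inject₁ {ℕ.suc k} (suc i) = cong sucIfNonzero (cyclicSuc-inject₁ i)

cyclicSuc-fromℕ : ∀ k → cyclicSuc (fromℕ k) ≡ zero
cyclicSuc-fromℕ ℕ.zero    = refl
cyclicSuc-fromℕ (ℕ.suc k) = cong sucIfNonzero (cyclicSuc-fromℕ k)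

cyclicSuc-cyclicPred : ∀ {k} (i : Fin (ℕ.suc k)) → cyclicSuc (cyclicPred i) ≡ i
cyclicSuc-cyclicPred {k} zero          = cyclicSuc-fromℕ k
cyclicSuc-cyclicPred {ℕ.suc k} (suc i) = cyclicSuc-inject₁ i

rotation : ∀ k → Permutation′ (ℕ.suc k)
rotation k = permutation cyclicSuc cyclicPred cyclicSuc-cyclicPred cyclicPred-cyclicSuc

tabulate-cyclicSuc : ∀ {A : Set} {k} (f : Fin (ℕ.suc k) → A) →
                     tabulate (f ∘ cyclicSuc) ≡ tabulate (f ∘ suc) ++ f zero ∷ []
tabulate-cyclicSuc {k = ℕ.zero}  f = refl
tabulate-cyclicSuc {k = ℕ.suc k} f = cong (f (suc zero) ∷_) (tabulate-cyclicSuc (f ∘ sucIfNonzero))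

tabulate-cast : ∀ {A : Set} {m n} (eq : m ≡ n) (f : Fin n → A) → tabulate (f ∘ cast eq) ≡ tabulate f
tabulate-cast refl f = tabulate-cong (λ i → cong f (cast-is-id refl i))

lookup-tabulate-cast : ∀ {A : Set} {n} (f : Fin n → A) (i : Fin (length (tabulate f))) →
                       lookup (tabulate f) i ≡ f (cast (length-tabulate f) i)
lookup-tabulate-cast {n = ℕ.suc n} f zero    = refl
lookup-tabulate-cast {n = ℕ.suc n} f (suc i) = lookup-tabulate-cast (f ∘ suc) i

module ToricHeaps {S : Set} (M : CoxeterMatrix S) where
  open CoxeterMatrix M
  open Coxeter M

  SameSet-refl : ∀ P → SameSet P P
  SameSet-refl P v = (λ p → p) , (λ p → p)

  SameSet-trans : ∀ {P Q R : Word → Set} → SameSet P Q → SameSet Q R → SameSet P R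
  SameSet-trans P=Q Q=R v = proj₁ (Q=R v) ∘ proj₁ (P=Q v) , proj₂ (P=Q v) ∘ proj₂ (Q=R v)

  ToricStep-sym : ∀ w {o o′} → ToricStep w o o′ → ToricStep w o′ o
  ToricStep-sym _ (inj₁ s)          = inj₂ (inj₁ s)
  ToricStep-sym _ (inj₂ (inj₁ s))   = inj₁ s
  ToricStep-sym _ (inj₂ (inj₂ agr)) = inj₂ (inj₂ (λ i j e → sym (agr i j e)))

  ≡tor-sym : ∀ w {o o′} → _≡tor_ w o o′ → _≡tor_ w o′ o
  ≡tor-sym w = reverse (ToricStep-sym w)

  ≡tor-pointwise : ∀ w {o o′ : Orientation w} → (∀ i j → o i j ≡ o′ i j) → _≡tor_ w o o′
  ≡tor-pointwise w o≗o′ = inj₂ (inj₂ (λ i j _ → o≗o′ i j)) ◅ ε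

  module Relabelling (x u : Word) (φ : Permutation (length x) (length u))
                     (letter-φ : ∀ i → letter x i ≡ letter u (φ ⟨$⟩ʳ i)) where

    pullback : Orientation u → Orientation x
    pullback o i j = o (φ ⟨$⟩ʳ i) (φ ⟨$⟩ʳ j)

    Edge-φ : ∀ {i j} → Edge x i j → Edge u (φ ⟨$⟩ʳ i) (φ ⟨$⟩ʳ j)
    Edge-φ {i} {j} (i≢j , commute) =
      (λ φi≡φj → i≢j (trans (sym (inverseˡ φ)) (trans (cong (φ ⟨$⟩ˡ_) φi≡φj) (inverseˡ φ)))) ,
      (λ m≡2 → commute (subst₂ (λ s t → m s t ≡ fin 2) (sym (letter-φ i)) (sym (letter-φ j)) m≡2))

    ≟-φ : ∀ v i → ⌊ i ≟ φ ⟨$⟩ˡ v ⌋ ≡ ⌊ φ ⟨$⟩ʳ i ≟ v ⌋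
    ≟-φ v i = isYes-cong (i ≟ φ ⟨$⟩ˡ v) (φ ⟨$⟩ʳ i ≟ v)
      (λ i≡ → trans (cong (φ ⟨$⟩ʳ_) i≡) (inverseʳ φ))
      (λ φi≡ → trans (sym (inverseˡ φ)) (cong (φ ⟨$⟩ˡ_) φi≡))

    flipAt-pullback : ∀ v o i j → flipAt x (φ ⟨$⟩ˡ v) (pullback o) i j ≡ pullback (flipAt u v o) i j
    flipAt-pullback v o i j =
      cong₂ (λ a b → if a ∨ b then not (pullback o i j) else pullback o i j) (≟-φ v i) (≟-φ v j)

    SourceToSink-pullback : ∀ {o o′} → SourceToSink u o o′ → SourceToSink x (pullback o) (pullback o′)
    SourceToSink-pullback {o} {o′} (v , source , agr) = φ ⟨$⟩ˡ v , source′ , agr′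
      where
      source′ : IsSource x (pullback o) (φ ⟨$⟩ˡ v)
      source′ j e = subst (λ z → o z (φ ⟨$⟩ʳ j) ≡ true) (sym (inverseʳ φ))
        (source (φ ⟨$⟩ʳ j) (subst (λ z → Edge u z (φ ⟨$⟩ʳ j)) (inverseʳ φ) (Edge-φ e)))
      agr′ : AgreeOnEdges x (flipAt x (φ ⟨$⟩ˡ v) (pullback o)) (pullback o′)
      agr′ i j e = trans (flipAt-pullback v o i j) (agr _ _ (Edge-φ e))

    ToricStep-pullback : ∀ {o o′} → ToricStep u o o′ → ToricStep x (pullback o) (pullback o′)
    ToricStep-pullback (inj₁ s)          = inj₁ (SourceToSink-pullback s)
    ToricStep-pullback (inj₂ (inj₁ s))   = inj₂ (inj₁ (SourceToSink-pullback s))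
    ToricStep-pullback (inj₂ (inj₂ agr)) = inj₂ (inj₂ (λ i j e → agr _ _ (Edge-φ e)))

    ≡tor-pullback : ∀ {o o′} → _≡tor_ u o o′ → _≡tor_ x (pullback o) (pullback o′)
    ≡tor-pullback = gmap pullback ToricStep-pullback

    Ltor-pullback : _≡tor_ x (ω x) (pullback (ω u)) → ∀ v → Ltor u v → Ltor x v
    Ltor-pullback ω≡φ*ω v (τ , τ-ext , shift) =
      ρ , ρ-ext , subst (λ z → CycShift z v) (sym ρ-word) shift
      where
      |u|≡|x| : length u ≡ length x
      |u|≡|x| = sym (↔⇒≡ φ)
      -- ρ puts vertex i of x at the position that τ gives to φ i.
      ρ : Permutation′ (length x)
      ρ = flip (φ ∘ₚ (flip τ ∘ₚ cast-id |u|≡|x|))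
      ρ-ext : _≡tor_ x (ω x) (induced x ρ)
      ρ-ext = ω≡φ*ω ◅◅ ≡tor-pullback τ-ext ◅◅ ≡tor-pointwise x (λ i j →
        <?-toℕ (sym (toℕ-cast |u|≡|x| _)) (sym (toℕ-cast |u|≡|x| _)))
      ρ-word : wordOf x ρ ≡ wordOf u τ
      ρ-word = begin
        map _ (allFin (length x))
          ≡⟨ map-tabulate _ _ ⟩
        tabulate (λ k → letter x (φ ⟨$⟩ˡ (τ ⟨$⟩ʳ cast _ k)))
          ≡⟨ tabulate-cong (λ _ → letter-φ⁻¹ _) ⟩
        tabulate (λ k → letter u (τ ⟨$⟩ʳ cast _ k))
          ≡⟨ tabulate-cast (sym |u|≡|x|) (letter u ∘ (τ ⟨$⟩ʳ_)) ⟩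
        tabulate (λ k → letter u (τ ⟨$⟩ʳ k))
          ≡⟨ map-tabulate _ _ ⟨
        map _ (allFin (length u))
          ∎
        where
        open ≡-Reasoning
        letter-φ⁻¹ : ∀ j → letter x (φ ⟨$⟩ˡ j) ≡ letter u j
        letter-φ⁻¹ j = trans (letter-φ _) (cong (letter u) (inverseʳ φ))

  Ltor-relabel : (x u : Word) (φ : Permutation (length x) (length u))
                 (letter-φ : ∀ i → letter x i ≡ letter u (φ ⟨$⟩ʳ i)) →
                 _≡tor_ x (ω x) (Relabelling.pullback x u φ letter-φ (ω u)) →
                 SameSet (Ltor u) (Ltor x)
  Ltor-relabel x u φ letter-φ ω≡φ*ω v =
    Relabelling.Ltor-pullback x u φ letter-φ ω≡φ*ω v ,
    Relabelling.Ltor-pullback u x (flip φ) letter-φ⁻¹ ω≡φ⁻¹*ω v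
    where
    letter-φ⁻¹ : ∀ j → letter u j ≡ letter x (φ ⟨$⟩ˡ j)
    letter-φ⁻¹ j = trans (cong (letter u) (sym (inverseʳ φ))) (sym (letter-φ _))
    ω≡φ⁻¹*ω : _≡tor_ u (ω u) (Relabelling.pullback u x (flip φ) letter-φ⁻¹ (ω x))
    ω≡φ⁻¹*ω = ≡tor-sym u (Relabelling.≡tor-pullback u x (flip φ) letter-φ⁻¹ ω≡φ*ω ◅◅
                          ≡tor-pointwise u (λ i j → cong₂ (ω u) (inverseʳ φ) (inverseʳ φ)))

  Ltor-tabulate : (u : Word) (σ : Permutation′ (length u)) → IsTotalToricExtension u σ →
                  SameSet (Ltor u) (Ltor (tabulate (λ k → letter u (σ ⟨$⟩ʳ k))))
  Ltor-tabulate u σ σ-ext = Ltor-relabel x u φ letter-φ ω≡φ*ω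
    where
    f : Fin (length u) → S
    f k = letter u (σ ⟨$⟩ʳ k)
    x : Word
    x = tabulate f
    φ : Permutation (length x) (length u)
    φ = cast-id (length-tabulate f) ∘ₚ σ
    letter-φ : ∀ i → letter x i ≡ letter u (φ ⟨$⟩ʳ i)
    letter-φ = lookup-tabulate-cast f
    ω≡φ*ω : _≡tor_ x (ω x) (Relabelling.pullback x u φ letter-φ (ω u))
    ω≡φ*ω = ≡tor-sym x (Relabelling.≡tor-pullback x u φ letter-φ σ-ext ◅◅ ≡tor-pointwise x (λ i j →
      <?-toℕ (position i) (position j)))
      where
      position : ∀ i → toℕ (σ ⟨$⟩ˡ (φ ⟨$⟩ʳ i)) ≡ toℕ i
      position i = trans (cong toℕ (inverseˡ σ)) (toℕ-cast _ i)

  Ltor-wordOf : (u : Word) (σ : Permutation′ (length u)) → IsTotalToricExtension u σ →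
                SameSet (Ltor u) (Ltor (wordOf u σ))
  Ltor-wordOf u σ σ-ext = subst (λ x → SameSet (Ltor u) (Ltor x))
    (sym (map-tabulate (λ k → k) (letter u ∘ (σ ⟨$⟩ʳ_)))) (Ltor-tabulate u σ σ-ext)

  Ltor-rotate : (c : S) (y : Word) → SameSet (Ltor (c ∷ y)) (Ltor (y ++ c ∷ []))
  Ltor-rotate c y = subst (λ x → SameSet (Ltor (c ∷ y)) (Ltor x)) rotated
    (Ltor-tabulate (c ∷ y) (rotation (length y)) rotation-ext)
    where
    rotated : tabulate (lookup (c ∷ y) ∘ cyclicSuc) ≡ y ++ c ∷ []
    rotated = trans (tabulate-cyclicSuc (lookup (c ∷ y))) (cong (_++ c ∷ []) (tabulate-lookup y))
    first-is-source : IsSource (c ∷ y) (ω (c ∷ y)) zero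
    first-is-source zero    (0≢0 , _) = ⊥-elim (0≢0 refl)
    first-is-source (suc j) _         = refl
    flipped : AgreeOnEdges (c ∷ y) (flipAt (c ∷ y) zero (ω (c ∷ y)))
                               (induced (c ∷ y) (rotation (length y)))
    flipped zero    zero    (0≢0 , _) = ⊥-elim (0≢0 refl)
    flipped zero    (suc j) _ = sym (isYes-false (fromℕ (length y) <? inject₁ j)
      (λ lt → <-asym (subst₂ ℕ._<_ (toℕ-fromℕ (length y)) (toℕ-inject₁ j) lt) (toℕ<n j)))
    flipped (suc i) zero    _ = sym (isYes-true (inject₁ i <? fromℕ (length y))
      (subst₂ ℕ._<_ (sym (toℕ-inject₁ i)) (sym (toℕ-fromℕ (length y))) (toℕ<n i)))
    flipped (suc i) (suc j) _ = isYes-cong (suc i <? suc j) (inject₁ i <? inject₁ j)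
      (λ { (s≤s i<j) → subst₂ ℕ._<_ (sym (toℕ-inject₁ i)) (sym (toℕ-inject₁ j)) i<j })
      (λ i<j → s≤s (subst₂ ℕ._<_ (toℕ-inject₁ i) (toℕ-inject₁ j) i<j))
    rotation-ext : IsTotalToricExtension (c ∷ y) (rotation (length y))
    rotation-ext = inj₁ (zero , first-is-source , flipped) ◅ ε

  Ltor-swap : ∀ a b → SameSet (Ltor (a ++ b)) (Ltor (b ++ a))
  Ltor-swap []      b =
    subst (λ z → SameSet (Ltor b) (Ltor z)) (sym (++-identityʳ b)) (SameSet-refl (Ltor b))
  Ltor-swap (c ∷ a) b = SameSet-trans (Ltor-rotate c (a ++ b))
    (subst₂ (λ z z′ → SameSet (Ltor z) (Ltor z′)) (sym (++-assoc a b (c ∷ []))) (++-assoc b (c ∷ []) a)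
            (Ltor-swap a (b ++ c ∷ [])))

  Ltor-cycShift : ∀ {x v} → CycShift x v → SameSet (Ltor x) (Ltor v)
  Ltor-cycShift (a , b , refl , refl) = Ltor-swap a b

mainTheorem4 : {S : Set} (M : CoxeterMatrix S) (w : Coxeter.Word M) →
    Coxeter.Reduced M w → Coxeter.TorReduced M w →
    Coxeter.TorOrderTheoretic M (Coxeter.Rtor M w) →
    Coxeter.SameSet M (Coxeter.Rtor M w) (Coxeter.Ltor M w)
mainTheorem4 M w _ _ (u , _ , Rtor=Ltor-u) with proj₁ (Rtor=Ltor-u w) ε
... | σ , σ-ext , shift =
  SameSet-trans Rtor=Ltor-u (SameSet-trans (Ltor-wordOf u σ σ-ext) (Ltor-cycShift shift))
  where open ToricHeaps M
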